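{- If $\mathcal M$ is a strongly $l$-coloured structure, $a,b\in M\setminus\mathrm{cl}(\emptyset)$ and $\mathcal M\models\xi(a,b)$, then $a$ and $b$ have the same colour in $\mathcal M$, i.e. $\mathcal M\models P_i(a)\wedge P_i(b)$ for some $i\in\{1,\dots,l\}$.
   Context: Fix $l\ge2$. Vocabularies: $V_{pre}$; $V_{col}=\{P_1,\dots,P_l\}$ unary; $V_{rel}$ finite nonempty with all arities $\ge2$; pairwise disjoint. $L_{pre},L_{rel},L$ are the first-order languages over $V_{pre}$, $V_{pre}\cup V_{rel}$, $V_{pre}\cup V_{col}\cup V_{rel}$. Pregeometry $(A,\mathrm{cl})$: reflexivity, monotonicity, exchange, finite character. Fixed $L_{pre}$-formulas $\theta_m(x_1,\dots,x_{m+1})$ define the closure in any structure ($a\in\mathrm{cl}(\{b_1..b_m\})$ iff $\theta_m(b_1..b_m,a)$, extended by finite character); $\mathbb G=\{\mathcal G_n\}$ are finite $L_{pre}$-structures in which this is a pregeometry (with the paper's standing assumptions on $\mathbb G$). In particular $\theta_0(x)$ expresses $x\in\mathrm{cl}(\emptyset)$ and $\theta_1(x,y)$ expresses $y\in\mathrm{cl}(\{x\})$. An $L$-structure $\mathcal M$ is strongly $l$-coloured if it is isomorphic to some $\mathcal M_0$ with $\mathcal M_0\restriction L_{pre}=\mathcal G_n$ such that: $a$ satisfies some $P_i$ iff $a\notin\mathrm{cl}(\emptyset)$; no $R\in V_{rel}$ holds on tuples from $\mathrm{cl}(\emptyset)$; if $a,b\notin\mathrm{cl}(\emptyset)$ and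 $a\in\mathrm{cl}(\{b\})$ then they do not satisfy different colours; and if $R\in V_{rel}$ and $R(\bar a)$ holds then some two elements of $\mathrm{cl}(\bar a)\setminus\mathrm{cl}(\emptyset)$ share no colour, and any $b,c\in\mathrm{cl}(\bar a)\setminus\mathrm{cl}(\emptyset)$ with $b\notin\mathrm{cl}(\{c\})$ share no colour. Let $R_1\in V_{rel}$ have minimal arity $r_1$ among symbols of $V_{rel}$. $\xi(x,y)$ is the $L_{rel}$-formula $$\theta_1(y,x)\vee\theta_1(x,y)\vee\exists y_2\dots y_l\,\exists\bar z\Big[\bigwedge_{i=2}^{l}\big(R_1(x,y_i,z_{(x,i,1)},\dots,z_{(x,i,r_1-2)})\wedge\neg\theta_1(x,y_i)\wedge R_1(y,y_i,z_{(y,i,1)},\dots,z_{(y,i,r_1-2)})\wedge\neg\theta_1(y,y_i)\big)\wedge\bigwedge_{2\le j<i\le l}\big(R_1(y_i,y_j,z_{(i,j,1)},\dots,z_{(i,j,r_1-2)})\wedge\neg\theta_1(y_j,y_i)\big)\Big],$$ where $\bar z$ lists all variables $z_{(x,i,s)},z_{(y,i,s)}$ ($2\le i\le l$) and $z_{(i,j,s)}$ ($2\le j<i\le l$), $1\le s\le r_1-2$ (there are none if $r_1=2$). -}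

module Defs where

open import Data.Nat using (ℕ; zero; suc; _+_; _∸_; _≤_)
open import Data.Fin using (Fin) renaming (_<_ to _<ᶠ_)
open import Data.Vec using (Vec; []; _∷_; map)
open import Data.Vec.Membership.Propositional using (_∈_)
open import Data.Product using (Σ; ∃; _×_; _,_)
open import Data.Sum using (_⊎_)
open import Data.Empty using (⊥)
open import Relation.Nullary using (¬_)
open import Relation.Binary.PropositionalEquality using (_≡_; _≢_)
open import Function.Bundles using (_⤖_; _⇔_; Bijection)

-- L_pre-structures, abstracted by the interpretations of the fixed
-- L_pre-formulas θ_m.  θ m (b₁ ∷ … ∷ bₘ ∷ []) a  is the interpretation of
-- θ_m(b₁,…,bₘ,a), i.e. "a ∈ cl({b₁,…,bₘ})".

ThetaInterp : Set → Set₁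
ThetaInterp A = (m : ℕ) → Vec A m → A → Set

record PreStr : Set₁ where
  field
    Carrier : Set
    θ       : ThetaInterp Carrier

Subset : Set → Set₁
Subset A = A → Set

-- The closure defined by the θ_m, extended to arbitrary sets by finite
-- character:  a ∈ cl(X)  iff  θ_m(b̄, a) for some finite b̄ from X.
cl : {A : Set} → ThetaInterp A → Subset A → Subset A
cl {A} θ X a = Σ ℕ λ m → Σ (Vec A m) λ bs → (∀ {x} → x ∈ bs → X x) × θ m bs a

cl∅ : {A : Set} → ThetaInterp A → Subset A
cl∅ θ = cl θ (λ _ → ⊥)

cl₁ : {A : Set} → ThetaInterp A → A → Subset A
cl₁ θ b = cl θ (λ x → x ≡ b)

clT : {A : Set} {n : ℕ} → ThetaInterp A → Vec A n → Subset A
clT θ as = cl θ (λ x → x ∈ as)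

_∪｛_｝ : {A : Set} → Subset A → A → Subset A
(X ∪｛ b ｝) x = X x ⊎ x ≡ b

-- "θ defines a pregeometry": the θ_m define the closure operator
-- (θ_m(b̄,a) iff a ∈ cl({b̄})), and cl satisfies the pregeometry axioms.
-- (Finite character holds by construction of cl.)
record IsPregeometry {A : Set} (θ : ThetaInterp A) : Set₁ where
  field
    defines      : ∀ m (bs : Vec A m) a → θ m bs a ⇔ clT θ bs a
    reflexivity  : ∀ (X : Subset A) a → X a → cl θ X a
    monotonicity : ∀ (X Y : Subset A) → (∀ x → X x → Y x) → ∀ a → cl θ X a → cl θ Y a
    transitivity : ∀ (X Y : Subset A) → (∀ y → Y y → cl θ X y) → ∀ a → cl θ Y a → cl θ X a
    exchange     : ∀ (X : Subset A) a b → cl θ (X ∪｛ b ｝) a → ¬ cl θ X a → cl θ (X ∪｛ a ｝) b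

IsFinite : Set → Set
IsFinite A = Σ ℕ λ N → A ⤖ Fin N

-- V_rel: a finite nonempty set of  suc k  relation symbols; symbol s has
-- arity  2 + ext s  (so all arities are ≥ 2).

record RelVoc : Set where
  field
    k   : ℕ
    ext : Fin (suc k) → ℕ
  arity : Fin (suc k) → ℕ
  arity s = 2 + ext s

-- L-structures for V_pre ∪ V_col ∪ V_rel, V_col = {P_1,…,P_l} (indexed by Fin l).
record LStr (l : ℕ) (V : RelVoc) : Set₁ where
  open RelVoc V
  field
    Carrier : Set
    θ       : ThetaInterp Carrier
    P       : Fin l → Carrier → Set
    R       : (s : Fin (suc k)) → Vec Carrier (arity s) → Set

-- The conditions of "strongly l-coloured" on a structure whose
-- L_pre-reduct is G (colours P, relations R on the carrier of G).

record StrongColouring (l : ℕ) (V : RelVoc) (G : PreStr)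
         (P : Fin l → PreStr.Carrier G → Set)
         (R : (s : Fin (suc (RelVoc.k V))) → Vec (PreStr.Carrier G) (RelVoc.arity V s) → Set) : Set₁ where
  open RelVoc V
  open PreStr G
  field
    coloured-iff  : ∀ a → (Σ (Fin l) λ i → P i a) ⇔ (¬ cl∅ θ a)
    rel-not-cl∅   : ∀ s (as : Vec Carrier (arity s)) → R s as → ¬ (∀ {x} → x ∈ as → cl∅ θ x)
    dep-same      : ∀ a b → ¬ cl∅ θ a → ¬ cl∅ θ b → cl₁ θ b a →
                      ¬ (Σ (Fin l) λ i → Σ (Fin l) λ j → i ≢ j × P i a × P j b)
    rel-twoDiff   : ∀ s (as : Vec Carrier (arity s)) → R s as →
                      Σ Carrier λ b → Σ Carrier λ c →
                        clT θ as b × ¬ cl∅ θ b × clT θ as c × ¬ cl∅ θ c ×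
                        ¬ (Σ (Fin l) λ i → P i b × P i c)
    rel-indepDiff : ∀ s (as : Vec Carrier (arity s)) → R s as →
                      ∀ b c → clT θ as b → ¬ cl∅ θ b → clT θ as c → ¬ cl∅ θ c →
                        ¬ cl₁ θ c b → ¬ (Σ (Fin l) λ i → P i b × P i c)

-- M is strongly l-coloured (w.r.t. 𝔾): M is isomorphic (via f) to some
-- M₀ whose L_pre-reduct is 𝔾 n and which satisfies the conditions above.
record StronglyColoured (l : ℕ) (V : RelVoc) (𝔾 : ℕ → PreStr) (M : LStr l V) : Set₁ where
  open RelVoc V
  open LStr M
  field
    n  : ℕ
    P₀ : Fin l → PreStr.Carrier (𝔾 n) → Set
    R₀ : (s : Fin (suc k)) → Vec (PreStr.Carrier (𝔾 n)) (arity s) → Set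
    f  : Carrier ⤖ PreStr.Carrier (𝔾 n)
  open Bijection f renaming (to to f⟨_⟩)
  field
    iso-θ : ∀ m (bs : Vec Carrier m) a → θ m bs a ⇔ PreStr.θ (𝔾 n) m (map f⟨_⟩ bs) f⟨ a ⟩
    iso-P : ∀ i a → P i a ⇔ P₀ i f⟨ a ⟩
    iso-R : ∀ s (as : Vec Carrier (arity s)) → R s as ⇔ R₀ s (map f⟨_⟩ as)
    colouring : StrongColouring l V (𝔾 n) P₀ R₀

-- Satisfaction of ξ(x,y) in M, where s₁ is the symbol R_1.
-- The variables y_2,…,y_l are indexed by Fin (l ∸ 1) (index i ↦ y_{i+2});
-- the tuples z̄ are given as functions into Vec Carrier (r₁ − 2).

Xi : (l : ℕ) (V : RelVoc) (M : LStr l V) (s₁ : Fin (suc (RelVoc.k V))) →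
     LStr.Carrier M → LStr.Carrier M → Set
Xi l V M s₁ x y =
  θ 1 (y ∷ []) x ⊎ θ 1 (x ∷ []) y ⊎
  (Σ (Fin (l ∸ 1) → Carrier) λ ys →
   Σ (Fin (l ∸ 1) → Vec Carrier (ext s₁)) λ zx →
   Σ (Fin (l ∸ 1) → Vec Carrier (ext s₁)) λ zy →
   Σ (Fin (l ∸ 1) → Fin (l ∸ 1) → Vec Carrier (ext s₁)) λ zz →
     (∀ i → R s₁ (x ∷ ys i ∷ zx i) × ¬ θ 1 (x ∷ []) (ys i) ×
            R s₁ (y ∷ ys i ∷ zy i) × ¬ θ 1 (y ∷ []) (ys i)) ×
     (∀ i j → j <ᶠ i → R s₁ (ys i ∷ ys j ∷ zz i j) × ¬ θ 1 (ys j ∷ []) (ys i)))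
  where
    open RelVoc V
    open LStr M

module Submission where

-- The argument is carried out in the coloured pregeometry M₀ underlying M
-- (whose L_pre-reduct is some 𝔾 n), and transported back along the
-- isomorphism f : M ≅ M₀.  In M₀:
--   * if one of a, b lies in the closure of the other, they share a colour
--     because dependent non-closed elements never carry different colours;
--   * otherwise ξ provides y₂,…,y_l, each R₁-related to both a and b and
--     pairwise R₁-related, with the relevant element outside the closure of
--     the other.  Independent elements of an R-tuple have different colours,
--     so the l−1 elements yᵢ carry pairwise different colours, none equal to
--     the colour of a or of b.  An injection Fin (l−1) → Fin l misses at most
--     one value (pigeonhole), hence a and b have the same colour.

open import Defs
open import Data.Nat using (ℕ; suc; _≤_)
open import Data.Nat.Properties using (1+n≰n)
open import Data.Fin using (Fin; zero; suc) renaming (_<_ to _<ᶠ_)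
open import Data.Fin.Properties using (_≟_; <-cmp; injective⇒≤)
open import Data.Product using (Σ; _×_; _,_; proj₁; proj₂)
open import Data.Sum using (inj₁; inj₂)
open import Data.Vec using (Vec; []; _∷_; map)
open import Data.Vec.Membership.Propositional using (_∈_)
open import Data.Vec.Relation.Unary.Any using (here; there)
open import Relation.Nullary using (¬_; contradiction)
open import Relation.Nullary.Decidable using (decidable-stable)
open import Relation.Binary.Definitions using (tri<; tri≈; tri>)
open import Relation.Binary.PropositionalEquality using (_≡_; _≢_; refl; sym; cong; subst)
open import Function using (_∘_)
open import Function.Bundles using (Equivalence; Bijection)
open import Function.Definitions using (Injective)

distinctBelow⇒injective : ∀ {m n} (c : Fin m → Fin n) →
                          (∀ i j → j <ᶠ i → c i ≢ c j) → Injective _≡_ _≡_ c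
distinctBelow⇒injective c distinct {i} {j} ci≡cj with <-cmp i j
... | tri< i<j _ _ = contradiction (sym ci≡cj) (distinct j i i<j)
... | tri≈ _ i≡j _ = i≡j
... | tri> _ _ j<i = contradiction ci≡cj (distinct i j j<i)

-- Pigeonhole: an injection Fin m → Fin (suc m) misses at most one value.
-- If it missed two different values x, y, then adjoining x and y would give
-- an injection Fin (suc (suc m)) → Fin (suc m).
injection-misses-at-most-one : ∀ {m} (c : Fin m → Fin (suc m)) → Injective _≡_ _≡_ c →
                               ∀ {x y} → (∀ k → c k ≢ x) → (∀ k → c k ≢ y) → x ≡ y
injection-misses-at-most-one {m} c c-inj {x} {y} x∉c y∉c =
  decidable-stable (x ≟ y) (λ x≢y → 1+n≰n (injective⇒≤ (extended-injective x≢y)))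
  where
    extended : Fin (suc (suc m)) → Fin (suc m)
    extended zero          = x
    extended (suc zero)    = y
    extended (suc (suc k)) = c k

    extended-injective : x ≢ y → Injective _≡_ _≡_ extended
    extended-injective x≢y {zero}        {zero}         _ = refl
    extended-injective x≢y {zero}        {suc zero}     e = contradiction e x≢y
    extended-injective x≢y {zero}        {suc (suc k)}  e = contradiction (sym e) (x∉c k)
    extended-injective x≢y {suc zero}    {zero}         e = contradiction (sym e) x≢y
    extended-injective x≢y {suc zero}    {suc zero}     _ = refl
    extended-injective x≢y {suc zero}    {suc (suc k)}  e = contradiction (sym e) (y∉c k)
    extended-injective x≢y {suc (suc k)} {zero}         e = contradiction e (x∉c k)
    extended-injective x≢y {suc (suc k)} {suc zero}     e = contradiction e (y∉c k)
    extended-injective x≢y {suc (suc k)} {suc (suc k′)} e = cong (λ k → suc (suc k)) (c-inj e)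

module Closure {A : Set} {θ : ThetaInterp A} (pg : IsPregeometry θ) where
  open IsPregeometry pg

  -- cl(∅) ⊆ cl({v}), so an element independent of some v is not in cl(∅).
  independent⇒nonclosed : ∀ {v x} → ¬ cl₁ θ v x → ¬ cl∅ θ x
  independent⇒nonclosed {v} {x} x∉clv x∈cl∅ = x∉clv (monotonicity _ _ (λ _ ()) x x∈cl∅)

  entry⇒inClosure : ∀ {n} {as : Vec A n} {x} → x ∈ as → clT θ as x
  entry⇒inClosure {x = x} x∈as = reflexivity _ x x∈as

  θ₁⇒cl₁ : ∀ {y x} → θ 1 (y ∷ []) x → cl₁ θ y x
  θ₁⇒cl₁ {y} {x} t = monotonicity _ _ onlyY x (Equivalence.to (defines 1 (y ∷ []) x) t)
    where
      onlyY : ∀ z → z ∈ (y ∷ []) → z ≡ y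
      onlyY z (here z≡y) = z≡y

  ¬θ₁⇒¬cl₁ : ∀ {y x} → ¬ θ 1 (y ∷ []) x → ¬ cl₁ θ y x
  ¬θ₁⇒¬cl₁ {y} {x} ¬t x∈cly =
    ¬t (Equivalence.from (defines 1 (y ∷ []) x) (monotonicity _ _ (λ _ → here) x x∈cly))

module Coloured {l : ℕ} (V : RelVoc) (G : PreStr)
  (P₀ : Fin l → PreStr.Carrier G → Set)
  (R₀ : (s : Fin (suc (RelVoc.k V))) → Vec (PreStr.Carrier G) (RelVoc.arity V s) → Set)
  (pg : IsPregeometry (PreStr.θ G)) (colouring : StrongColouring l V G P₀ R₀) where
  open PreStr G
  open StrongColouring colouring
  open Closure pg

  structure : LStr l V
  structure = record { Carrier = Carrier ; θ = θ ; P = P₀ ; R = R₀ }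

  ShareColour : Carrier → Carrier → Set
  ShareColour u v = Σ (Fin l) λ i → P₀ i u × P₀ i v

  colourOf : ∀ x → ¬ cl∅ θ x → Fin l
  colourOf x x∉cl∅ = proj₁ (Equivalence.from (coloured-iff x) x∉cl∅)

  colourOf-colours : ∀ x (x∉cl∅ : ¬ cl∅ θ x) → P₀ (colourOf x x∉cl∅) x
  colourOf-colours x x∉cl∅ = proj₂ (Equivalence.from (coloured-iff x) x∉cl∅)

  dependent⇒sameColour : ∀ {u v i j} → ¬ cl∅ θ u → ¬ cl∅ θ v → cl₁ θ v u →
                         P₀ i u → P₀ j v → i ≡ j
  dependent⇒sameColour {u} {v} {i} {j} u∉cl∅ v∉cl∅ u∈clv iu jv =
    decidable-stable (i ≟ j) (λ i≢j → dep-same u v u∉cl∅ v∉cl∅ u∈clv (i , j , i≢j , iu , jv))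

  dependent⇒shareColour : ∀ {u v} → ¬ cl∅ θ u → ¬ cl∅ θ v → cl₁ θ v u → ShareColour u v
  dependent⇒shareColour {u} {v} u∉cl∅ v∉cl∅ u∈clv = colourOf u u∉cl∅ , iu , iv
    where
      iu : P₀ (colourOf u u∉cl∅) u
      iu = colourOf-colours u u∉cl∅
      jv : P₀ (colourOf v v∉cl∅) v
      jv = colourOf-colours v v∉cl∅
      iv : P₀ (colourOf u u∉cl∅) v
      iv = subst (λ k → P₀ k v) (sym (dependent⇒sameColour u∉cl∅ v∉cl∅ u∈clv iu jv)) jv

  related⇒distinctColours : ∀ {s as u v i j} → R₀ s as → u ∈ as → v ∈ as →
                            ¬ cl∅ θ v → ¬ cl₁ θ v u → P₀ i u → P₀ j v → i ≢ j
  related⇒distinctColours {s} {as} {u} {v} r u∈as v∈as v∉cl∅ u∉clv iu jv i≡j =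
    rel-indepDiff s as r u v (entry⇒inClosure u∈as) (independent⇒nonclosed u∉clv)
      (entry⇒inClosure v∈as) v∉cl∅ u∉clv (_ , iu , subst (λ k → P₀ k v) (sym i≡j) jv)

-- The core of Lemma 3.4 inside the coloured pregeometry (for any l ≥ 1; the
-- witnesses yᵢ of ξ are indexed by Fin (l − 1) = Fin m).
module Core {m : ℕ} (V : RelVoc) (G : PreStr)
  (P₀ : Fin (suc m) → PreStr.Carrier G → Set)
  (R₀ : (s : Fin (suc (RelVoc.k V))) → Vec (PreStr.Carrier G) (RelVoc.arity V s) → Set)
  (pg : IsPregeometry (PreStr.θ G)) (colouring : StrongColouring (suc m) V G P₀ R₀) where
  open PreStr G
  open Closure pg
  open Coloured V G P₀ R₀ pg colouring

  xi⇒shareColour : ∀ s₁ {u v} → ¬ cl∅ θ u → ¬ cl∅ θ v →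
                   Xi (suc m) V structure s₁ u v → ShareColour u v
  xi⇒shareColour s₁ u∉cl∅ v∉cl∅ (inj₁ u∈clv) = dependent⇒shareColour u∉cl∅ v∉cl∅ (θ₁⇒cl₁ u∈clv)
  xi⇒shareColour s₁ u∉cl∅ v∉cl∅ (inj₂ (inj₁ v∈clu)) =
    let (i , iv , iu) = dependent⇒shareColour v∉cl∅ u∉cl∅ (θ₁⇒cl₁ v∈clu) in i , iu , iv
  xi⇒shareColour s₁ {u} {v} u∉cl∅ v∉cl∅ (inj₂ (inj₂ (ys , zu , zv , zz , toUV , chain))) =
    cu , colourOf-colours u u∉cl∅ , subst (λ k → P₀ k v) (sym cu≡cv) (colourOf-colours v v∉cl∅)
    where
      cu cv : Fin (suc m)
      cu = colourOf u u∉cl∅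
      cv = colourOf v v∉cl∅

      y∉cl∅ : ∀ k → ¬ cl∅ θ (ys k)
      y∉cl∅ k = independent⇒nonclosed (¬θ₁⇒¬cl₁ (proj₁ (proj₂ (toUV k))))

      c : Fin m → Fin (suc m)
      c k = colourOf (ys k) (y∉cl∅ k)

      -- yᵢ ∉ cl({yⱼ}) for j < i, and they are R₁-related.
      c-injective : Injective _≡_ _≡_ c
      c-injective = distinctBelow⇒injective c λ i j j<i →
        related⇒distinctColours (proj₁ (chain i j j<i)) (here refl) (there (here refl))
          (y∉cl∅ j) (¬θ₁⇒¬cl₁ (proj₂ (chain i j j<i)))
          (colourOf-colours (ys i) (y∉cl∅ i)) (colourOf-colours (ys j) (y∉cl∅ j))

      -- yₖ ∉ cl({u}) and R₁(u, yₖ, …), so yₖ is not coloured like u.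
      cu∉c : ∀ k → c k ≢ cu
      cu∉c k = related⇒distinctColours (proj₁ (toUV k)) (there (here refl)) (here refl)
        u∉cl∅ (¬θ₁⇒¬cl₁ (proj₁ (proj₂ (toUV k))))
        (colourOf-colours (ys k) (y∉cl∅ k)) (colourOf-colours u u∉cl∅)

      cv∉c : ∀ k → c k ≢ cv
      cv∉c k = related⇒distinctColours (proj₁ (proj₂ (proj₂ (toUV k)))) (there (here refl))
        (here refl) v∉cl∅ (¬θ₁⇒¬cl₁ (proj₂ (proj₂ (proj₂ (toUV k)))))
        (colourOf-colours (ys k) (y∉cl∅ k)) (colourOf-colours v v∉cl∅)

      cu≡cv : cu ≡ cv
      cu≡cv = injection-misses-at-most-one c c-injective cu∉c cv∉c

module Transport {l : ℕ} {V : RelVoc} {𝔾 : ℕ → PreStr} {M : LStr l V}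
  (sc : StronglyColoured l V 𝔾 M) (pgs : ∀ n → IsPregeometry (PreStr.θ (𝔾 n))) where
  open LStr M
  open StronglyColoured sc
  open Coloured V (𝔾 n) P₀ R₀ (pgs n) colouring using (structure; ShareColour)

  F : Carrier → PreStr.Carrier (𝔾 n)
  F = Bijection.to f

  -- The only finite subsets of ∅ are empty, so cl(∅) is defined by θ₀.
  nonclosed-transport : ∀ {x} → ¬ cl∅ θ x → ¬ cl∅ (PreStr.θ (𝔾 n)) (F x)
  nonclosed-transport {x} x∉cl∅ (0 , [] , _ , t) =
    x∉cl∅ (0 , [] , (λ ()) , Equivalence.from (iso-θ 0 [] x) t)
  nonclosed-transport x∉cl∅ (suc _ , _ ∷ _ , inEmpty , _) = inEmpty (here refl)

  xi-transport : ∀ s₁ {a b} → Xi l V M s₁ a b → Xi l V structure s₁ (F a) (F b)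
  xi-transport s₁ {a} {b} (inj₁ t) = inj₁ (Equivalence.to (iso-θ 1 (b ∷ []) a) t)
  xi-transport s₁ {a} {b} (inj₂ (inj₁ t)) = inj₂ (inj₁ (Equivalence.to (iso-θ 1 (a ∷ []) b) t))
  xi-transport s₁ {a} {b} (inj₂ (inj₂ (ys , za , zb , zz , toAB , chain))) =
    inj₂ (inj₂ (F ∘ ys , map F ∘ za , map F ∘ zb , (λ i j → map F (zz i j)) ,
                 toAB′ , λ i j j<i → R-to (proj₁ (chain i j j<i)) , ¬θ₁-to (proj₂ (chain i j j<i))))
    where
      R-to : ∀ {as} → R s₁ as → R₀ s₁ (map F as)
      R-to {as} = Equivalence.to (iso-R s₁ as)

      ¬θ₁-to : ∀ {y x} → ¬ θ 1 (y ∷ []) x → ¬ PreStr.θ (𝔾 n) 1 (F y ∷ []) (F x)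
      ¬θ₁-to {y} {x} ¬t = ¬t ∘ Equivalence.from (iso-θ 1 (y ∷ []) x)

      toAB′ : ∀ i → R₀ s₁ (F a ∷ F (ys i) ∷ map F (za i)) × ¬ PreStr.θ (𝔾 n) 1 (F a ∷ []) (F (ys i)) ×
                    R₀ s₁ (F b ∷ F (ys i) ∷ map F (zb i)) × ¬ PreStr.θ (𝔾 n) 1 (F b ∷ []) (F (ys i))
      toAB′ i = let (ra , ¬ta , rb , ¬tb) = toAB i in R-to ra , ¬θ₁-to ¬ta , R-to rb , ¬θ₁-to ¬tb

  shareColour-reflect : ∀ {a b} → ShareColour (F a) (F b) → Σ (Fin l) λ i → P i a × P i b
  shareColour-reflect {a} {b} (i , ia , ib) =
    i , Equivalence.from (iso-P i a) ia , Equivalence.from (iso-P i b) ib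

lemma3p4 : (l : ℕ) → 2 ≤ l → (V : RelVoc) →
           (s₁ : Fin (suc (RelVoc.k V))) →
           (∀ s → RelVoc.ext V s₁ ≤ RelVoc.ext V s) →
           (𝔾 : ℕ → PreStr) →
           (∀ n → IsFinite (PreStr.Carrier (𝔾 n))) →
           (∀ n → IsPregeometry (PreStr.θ (𝔾 n))) →
           (M : LStr l V) → StronglyColoured l V 𝔾 M →
           (a b : LStr.Carrier M) →
           ¬ cl∅ (LStr.θ M) a → ¬ cl∅ (LStr.θ M) b →
           Xi l V M s₁ a b →
           Σ (Fin l) λ i → LStr.P M i a × LStr.P M i b
lemma3p4 (suc m) _ V s₁ _ 𝔾 _ pgs M sc a b a∉cl∅ b∉cl∅ xi =
  shareColour-reflect
    (xi⇒shareColour s₁ (nonclosed-transport a∉cl∅) (nonclosed-transport b∉cl∅)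
      (xi-transport s₁ xi))
  where
    open Transport sc pgs
    open StronglyColoured sc using (n; P₀; R₀; colouring)
    open Core V (𝔾 n) P₀ R₀ (pgs n) colouring
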